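{- Let $G$ be a graph of order $n$ with $\alpha(G)\leq 3$. Then the independence polynomial $I(G^{*};x)$ is unimodal, and it has a mode $k$ satisfying \[ \left\lfloor \frac{n+1}{2}\right\rfloor \leq k\leq \left\lfloor \frac{n+1}{2}\right\rfloor +1. \] In particular, if $\alpha(G)=2$ and $n$ is odd, or if $\alpha(G)=1$, then $I(G^{*};x)$ has mode $k=\left\lfloor \frac{n+1}{2}\right\rfloor$.
   Context: All graphs are simple (finite, undirected, no loops or multiple edges). A stable set is a set of pairwise non-adjacent vertices; $\alpha(G)$ is the maximum size of a stable set in $G$. If $s_k$ denotes the number of stable sets of cardinality $k$ in $G$, the independence polynomial is $I(G;x)=\sum_{k=0}^{\alpha(G)} s_k x^k$. A sequence $a_0,\dots,a_n$ is unimodal if there is an index $k$ (called a mode) with $a_0\leq a_1\leq\cdots\leq a_k\geq a_{k+1}\geq\cdots\geq a_n$; a polynomial is unimodal if its coefficient sequence is, and its mode is the mode of that sequence. For a graph $G$ with vertex set $\{v_1,\dots,v_n\}$, $G^{*}$ is the graph obtained by adding $n$ new vertices $u_1,\dots,u_n$ and the edges $u_iv_i$ ($1\le i\le n$), i.e. appending a single pendant edge to each vertex of $G$. -}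

module Defs where

open import Data.Nat using (ℕ; zero; suc; _+_; _≤_; _<_; _⊔_; _/_; _≡ᵇ_)
open import Data.Bool using (Bool; true; false; _∧_; not; if_then_else_)
open import Data.Fin using (Fin; splitAt; _≟_)
open import Data.Fin.Subset using (Subset; ∣_∣)
open import Data.Vec using (Vec; []; _∷_; lookup)
open import Data.List using (List; []; _∷_; map; _++_; allFin; foldr; length; filterᵇ)
open import Data.Bool.ListAction using (and)
open import Data.Sum using (inj₁; inj₂)
open import Data.Product using (_×_; ∃)
open import Relation.Nullary using (¬_)
open import Relation.Nullary.Decidable using (⌊_⌋)
open import Relation.Binary.PropositionalEquality using (_≡_)

record Graph (n : ℕ) : Set where
  field
    adj : Fin n → Fin n → Bool
open Graph public

IsSimple : {n : ℕ} → Graph n → Set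
IsSimple {n} G = (∀ (i j : Fin n) → adj G i j ≡ adj G j i) × (∀ (i : Fin n) → adj G i i ≡ false)

allSubsets : (n : ℕ) → List (Subset n)
allSubsets zero = [] ∷ []
allSubsets (suc n) = map (true ∷_) (allSubsets n) ++ map (false ∷_) (allSubsets n)

isStable : {n : ℕ} → Graph n → Subset n → Bool
isStable {n} G S =
  and (map (λ i → and (map (λ j → not (lookup S i ∧ lookup S j ∧ adj G i j)) (allFin n))) (allFin n))

α : {n : ℕ} → Graph n → ℕ
α {n} G = foldr _⊔_ 0 (map ∣_∣ (filterᵇ (isStable G) (allSubsets n)))

s : {n : ℕ} → Graph n → ℕ → ℕ
s {n} G k = length (filterᵇ (λ S → isStable G S ∧ (∣ S ∣ ≡ᵇ k)) (allSubsets n))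

-- G*: vertices v_i = inj₁ i (the original vertices), u_i = inj₂ i (new pendant vertices).
star : {n : ℕ} → Graph n → Graph (n + n)
adj (star {n} G) x y with splitAt n x | splitAt n y
... | inj₁ i | inj₁ j = adj G i j
... | inj₁ i | inj₂ j = ⌊ i ≟ j ⌋
... | inj₂ i | inj₁ j = ⌊ i ≟ j ⌋
... | inj₂ i | inj₂ j = false

IsMode : (ℕ → ℕ) → ℕ → ℕ → Set
IsMode a N k = k ≤ N × (∀ i → i < k → a i ≤ a (suc i)) × (∀ i → k ≤ i → i < N → a (suc i) ≤ a i)

Unimodal : (ℕ → ℕ) → ℕ → Set
Unimodal a N = ∃ λ k → IsMode a N k

-- The independence polynomial I(G;x) = Σ_{k=0}^{α(G)} s_k x^k, via its coefficient sequence.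
IsModeOfI : {n : ℕ} → Graph n → ℕ → Set
IsModeOfI G k = IsMode (s G) (α G) k

IsUnimodalI : {n : ℕ} → Graph n → Set
IsUnimodalI G = Unimodal (s G) (α G)

{-# OPTIONS --safe #-}
module Submission where

-- A stable set of G* is a stable set x of G together with pendant vertices u_i for i ∉ x, so
--   s_k(G*) = Σ_{x stable in G} C(n − |x|, k − |x|).
-- As a function of k, the summand for x is a row of Pascal's triangle delayed by |x|; by
-- (k+1) C(z,k+1) + (k+1) C(z,k) = (z+1) C(z,k) it rises while 2k+1 ≤ n + |x| and falls once
-- n + |x| ≤ 2k+1. Since 0 ≤ |x| ≤ α(G) ≤ 3, with m = ⌊(n+1)/2⌋ every summand rises below m and
-- falls from m+1 on, so m or m+1 is a mode. If α(G) = 1, or α(G) = 2 and n is odd, every summand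
-- already falls from m. Both candidates are at most α(G*): s_m(G*) ≥ s_0(G*) = 1, and
-- s_{m+1}(G*) > s_m(G*) whenever m+1 is chosen.

open import Defs
open import Data.Bool using (Bool; true; false; T; not; _∧_; if_then_else_)
open import Data.Bool.ListAction using (all)
open import Data.Bool.Properties using (T?; T-∧; T-≡; ⇔→≡; ∧-assoc; ∧-comm; ∧-zeroʳ)
open import Data.Empty using (⊥-elim)
open import Data.Fin as Fin using (Fin; zero; suc; splitAt; join; _↑ˡ_; _↑ʳ_)
open import Data.Fin.Properties using (join-splitAt; splitAt-↑ˡ; splitAt-↑ʳ)
open import Data.Fin.Subset using (Subset; ∣_∣; ∁) renaming (⊥ to ∅)
open import Data.Fin.Subset.Properties using (∣∁p∣≡n∸∣p∣; ∣p∣≤n; ∣⊥∣≡0)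
open import Data.List as List using (List; []; _∷_; map; length; filterᵇ; allFin)
open import Data.List.Properties using (map-++; map-∘; map-cong; foldr-forcesᵇ; filter-some)
open import Data.List.Membership.Propositional using (_∈_; lose)
open import Data.List.Membership.Propositional.Properties
  using (∈-map⁺; ∈-++⁺ˡ; ∈-++⁺ʳ; ∈-allFin; ∈-filter⁺; ∈-filter⁻)
open import Data.List.Relation.Unary.All as All using (All; []; _∷_)
open import Data.List.Relation.Unary.All.Properties using (all⁺; all⁻; tabulate⁺)
open import Data.List.Relation.Unary.Any using (here)
open import Data.Nat
open import Data.Nat.Combinatorics using (_C_; nCk+nC[k+1]≡[n+1]C[k+1]; nC1≡n)
open import Data.Nat.DivMod using (m≡m%n+[m/n]*n; m/n*n≤m; m%n<n; %-distribˡ-+)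
open import Data.Nat.ListAction using (sum)
open import Data.Nat.ListAction.Properties using (sum-++)
open import Data.Nat.Properties
open import Data.Product using (_×_; _,_; proj₁; proj₂; ∃)
open import Data.Product.Function.NonDependent.Propositional using (_×-⇔_)
open import Data.Sum using (_⊎_; inj₁; inj₂; [_,_]; [_,_]′)
open import Data.Vec using (_∷_; []; _++_; lookup)
open import Data.Vec.Properties using (lookup-++ˡ; lookup-++ʳ; lookup-replicate)
open import Function using (_∘_; _⇔_; mk⇔; Equivalence)
open import Function.Construct.Composition using (_⇔-∘_)
open import Function.Construct.Symmetry using (⇔-sym)
open import Relation.Binary.PropositionalEquality
open import Relation.Nullary using (¬_; yes; no)
open import Relation.Nullary.Decidable using (⌊_⌋; toWitness; fromWitness)

open Equivalence using (to; from)

private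
  variable
    A : Set
    m n : ℕ

count : (A → Bool) → List A → ℕ
count p xs = sum (map (λ x → if p x then 1 else 0) xs)

length-filterᵇ : ∀ (p : A → Bool) xs → length (filterᵇ p xs) ≡ count p xs
length-filterᵇ p []       = refl
length-filterᵇ p (x ∷ xs) with p x
... | true  = cong suc (length-filterᵇ p xs)
... | false = length-filterᵇ p xs

sum-map-filterᵇ : ∀ (f : A → ℕ) p xs →
  sum (map f (filterᵇ p xs)) ≡ sum (map (λ x → if p x then f x else 0) xs)
sum-map-filterᵇ f p []       = refl
sum-map-filterᵇ f p (x ∷ xs) with p x
... | true  = cong (f x +_) (sum-map-filterᵇ f p xs)
... | false = sum-map-filterᵇ f p xs

sum-map-mono : ∀ {f g : A → ℕ} {xs} → All (λ x → f x ≤ g x) xs → sum (map f xs) ≤ sum (map g xs)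
sum-map-mono []       = z≤n
sum-map-mono (h ∷ hs) = +-mono-≤ h (sum-map-mono hs)

count-cong : ∀ {p q : A → Bool} → (∀ x → p x ≡ q x) → ∀ xs → count p xs ≡ count q xs
count-cong p≗q xs = cong sum (map-cong (λ x → cong (λ b → if b then 1 else 0) (p≗q x)) xs)

count-false : ∀ (xs : List A) → count (λ _ → false) xs ≡ 0
count-false []       = refl
count-false (_ ∷ xs) = count-false xs

count-∧ˡ : ∀ b (p : A → Bool) xs → count (λ x → b ∧ p x) xs ≡ (if b then count p xs else 0)
count-∧ˡ true  p xs = refl
count-∧ˡ false p xs = count-false xs

0<length⇒∃∈ : ∀ (xs : List A) → 0 < length xs → ∃ (_∈ xs)
0<length⇒∃∈ (x ∷ _) _ = x , here refl

∈-allSubsets : ∀ (x : Subset n) → x ∈ allSubsets n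
∈-allSubsets []                  = here refl
∈-allSubsets (true ∷ x)          = ∈-++⁺ˡ (∈-map⁺ (true ∷_) (∈-allSubsets x))
∈-allSubsets {suc n} (false ∷ x) =
  ∈-++⁺ʳ (map (true ∷_) (allSubsets n)) (∈-map⁺ (false ∷_) (∈-allSubsets x))

sum-allSubsets-suc : ∀ (f : Subset (suc n) → ℕ) →
  sum (map f (allSubsets (suc n))) ≡
  sum (map (f ∘ (true ∷_)) (allSubsets n)) + sum (map (f ∘ (false ∷_)) (allSubsets n))
sum-allSubsets-suc {n} f = begin
  sum (map f (map (true ∷_) S List.++ map (false ∷_) S))
    ≡⟨ cong sum (map-++ f (map (true ∷_) S) _) ⟩
  sum (map f (map (true ∷_) S) List.++ map f (map (false ∷_) S))
    ≡⟨ sum-++ (map f (map (true ∷_) S)) _ ⟩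
  sum (map f (map (true ∷_) S)) + sum (map f (map (false ∷_) S))
    ≡⟨ cong₂ _+_ (cong sum (map-∘ S)) (cong sum (map-∘ S)) ⟨
  sum (map (f ∘ (true ∷_)) S) + sum (map (f ∘ (false ∷_)) S) ∎
  where
  open ≡-Reasoning
  S : List (Subset n)
  S = allSubsets n

sum-allSubsets-++ : ∀ m (f : Subset (m + n) → ℕ) →
  sum (map f (allSubsets (m + n))) ≡
  sum (map (λ x → sum (map (λ y → f (x ++ y)) (allSubsets n))) (allSubsets m))
sum-allSubsets-++ zero          f = sym (+-identityʳ _)
sum-allSubsets-++ {n} (suc m) f = begin
  sum (map f (allSubsets (suc m + n)))
    ≡⟨ sum-allSubsets-suc f ⟩
  sum (map (f ∘ (true ∷_)) (allSubsets (m + n))) + sum (map (f ∘ (false ∷_)) (allSubsets (m + n)))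
    ≡⟨ cong₂ _+_ (sum-allSubsets-++ m _) (sum-allSubsets-++ m _) ⟩
  sum (map (F ∘ (true ∷_)) (allSubsets m)) + sum (map (F ∘ (false ∷_)) (allSubsets m))
    ≡⟨ sum-allSubsets-suc F ⟨
  sum (map F (allSubsets (suc m))) ∎
  where
  open ≡-Reasoning
  F : Subset (suc m) → ℕ
  F x = sum (map (λ y → f (x ++ y)) (allSubsets n))

∣p++q∣≡∣p∣+∣q∣ : ∀ (p : Subset m) (q : Subset n) → ∣ p ++ q ∣ ≡ ∣ p ∣ + ∣ q ∣
∣p++q∣≡∣p∣+∣q∣ []          q = refl
∣p++q∣≡∣p∣+∣q∣ (true ∷ p)  q = cong suc (∣p++q∣≡∣p∣+∣q∣ p q)
∣p++q∣≡∣p∣+∣q∣ (false ∷ p) q = ∣p++q∣≡∣p∣+∣q∣ p q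

∣p∣+∣∁p∣≡n : ∀ (p : Subset n) → ∣ p ∣ + ∣ ∁ p ∣ ≡ n
∣p∣+∣∁p∣≡n p = trans (cong (∣ p ∣ +_) (∣∁p∣≡n∸∣p∣ p)) (m+[n∸m]≡n (∣p∣≤n p))

splitAt-elim : ∀ m {n} (P : Fin (m + n) → Set) →
  (∀ i → P (i ↑ˡ n)) → (∀ j → P (m ↑ʳ j)) → ∀ k → P k
splitAt-elim m {n} P left right k =
  subst P (join-splitAt m n k) ([_,_] {C = P ∘ join m n} left right (splitAt m k))

T-⇔⇒≡ : ∀ {a b} → T a ⇔ T b → a ≡ b
T-⇔⇒≡ Ta⇔Tb = ⇔→≡ (T-≡ ⇔-∘ (Ta⇔Tb ⇔-∘ ⇔-sym T-≡))

T-all-allFin : ∀ {p : Fin n → Bool} → T (all p (allFin n)) ⇔ (∀ i → T (p i))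
T-all-allFin {p = p} = mk⇔ (λ h i → All.lookup (all⁺ p _ h) (∈-allFin i)) (λ h → all⁻ p (tabulate⁺ h))

T-nand : ∀ a b → T (not (a ∧ b)) ⇔ (T a → ¬ T b)
T-nand false _     = mk⇔ (λ _ ()) _
T-nand true  false = mk⇔ (λ _ _ ()) _
T-nand true  true  = mk⇔ (λ ()) (λ h → h _ _)

T-nand³ : ∀ a b c → T (not (a ∧ b ∧ c)) ⇔ (T a → T b → ¬ T c)
T-nand³ false _ _ = mk⇔ (λ _ ()) _
T-nand³ true  b c = mk⇔ (λ h _ → to (T-nand b c) h) (λ h → from (T-nand b c) (h _))

Stable : Graph n → Subset n → Set
Stable G S = ∀ i j → T (lookup S i) → T (lookup S j) → ¬ T (adj G i j)

T-isStable : ∀ (G : Graph n) S → T (isStable G S) ⇔ Stable G S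
T-isStable G S = mk⇔
  (λ h i j → to (T-nand³ _ _ _) (to T-all-allFin (to T-all-allFin h i) j))
  (λ h → from T-all-allFin (λ i → from T-all-allFin (λ j → from (T-nand³ _ _ _) (h i j))))

stableSets : Graph n → List (Subset n)
stableSets {n} G = filterᵇ (isStable G) (allSubsets n)

∣S∣≤α : ∀ (G : Graph n) {S} → S ∈ stableSets G → ∣ S ∣ ≤ α G
∣S∣≤α G S∈ = All.lookup (foldr-forcesᵇ ⊔-forces 0 (map ∣_∣ (stableSets G)) ≤-refl) (∈-map⁺ ∣_∣ S∈)
  where
  ⊔-forces : ∀ x y → x ⊔ y ≤ α G → x ≤ α G × y ≤ α G
  ⊔-forces x y h = m⊔n≤o⇒m≤o x y h , m⊔n≤o⇒n≤o x y h

0<s⇒≤α : ∀ (G : Graph n) k → 0 < s G k → k ≤ α G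
0<s⇒≤α {n} G k 0<s =
  let S , S∈         = 0<length⇒∃∈ (filterᵇ P (allSubsets n)) 0<s
      S∈all , S-ok   = ∈-filter⁻ (T? ∘ P) {xs = allSubsets n} S∈
      stable , ∣S∣≡k = to T-∧ S-ok
  in subst (_≤ α G) (≡ᵇ⇒≡ ∣ S ∣ k ∣S∣≡k) (∣S∣≤α G (∈-filter⁺ (T? ∘ isStable G) S∈all stable))
  where
  P : Subset n → Bool
  P S = isStable G S ∧ (∣ S ∣ ≡ᵇ k)

0<s[0] : ∀ (G : Graph n) → 0 < s G 0
0<s[0] {n} G = filter-some (T? ∘ P) (lose (∈-allSubsets empty) (from T-∧ (empty-stable , ∣empty∣≡0)))
  where
  P : Subset n → Bool
  P S = isStable G S ∧ (∣ S ∣ ≡ᵇ 0)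
  empty : Subset n
  empty = ∅
  empty-stable : T (isStable G empty)
  empty-stable = from (T-isStable G empty) (λ i _ i∈∅ → ⊥-elim (subst T (lookup-replicate i false) i∈∅))
  ∣empty∣≡0 : T (∣ empty ∣ ≡ᵇ 0)
  ∣empty∣≡0 = ≡⇒≡ᵇ ∣ empty ∣ 0 (∣⊥∣≡0 n)

disjointᵇ : Subset n → Subset n → Bool
disjointᵇ []      []      = true
disjointᵇ (a ∷ x) (b ∷ y) = not (a ∧ b) ∧ disjointᵇ x y

Disjoint : Subset n → Subset n → Set
Disjoint x y = ∀ i → T (lookup x i) → ¬ T (lookup y i)

T-disjointᵇ : ∀ (x y : Subset n) → T (disjointᵇ x y) ⇔ Disjoint x y
T-disjointᵇ []      []      = mk⇔ (λ _ ()) _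
T-disjointᵇ (a ∷ x) (b ∷ y) = mk⇔ to′ from′
  where
  to′ : T (disjointᵇ (a ∷ x) (b ∷ y)) → Disjoint (a ∷ x) (b ∷ y)
  to′ h zero    = to (T-nand a b) (proj₁ (to T-∧ h))
  to′ h (suc i) = to (T-disjointᵇ x y) (proj₂ (to T-∧ h)) i
  from′ : Disjoint (a ∷ x) (b ∷ y) → T (disjointᵇ (a ∷ x) (b ∷ y))
  from′ d = from T-∧ (from (T-nand a b) (d zero) , from (T-disjointᵇ x y) (d ∘ suc))

module _ {n} (G : Graph n) where

  star-adj-vv : ∀ i j → adj (star G) (i ↑ˡ n) (j ↑ˡ n) ≡ adj G i j
  star-adj-vv i j rewrite splitAt-↑ˡ n i n | splitAt-↑ˡ n j n = refl

  star-adj-vu : ∀ i j → adj (star G) (i ↑ˡ n) (n ↑ʳ j) ≡ ⌊ i Fin.≟ j ⌋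
  star-adj-vu i j rewrite splitAt-↑ˡ n i n | splitAt-↑ʳ n n j = refl

  star-adj-uv : ∀ i j → adj (star G) (n ↑ʳ i) (j ↑ˡ n) ≡ ⌊ i Fin.≟ j ⌋
  star-adj-uv i j rewrite splitAt-↑ʳ n n i | splitAt-↑ˡ n j n = refl

  star-adj-uu : ∀ i j → adj (star G) (n ↑ʳ i) (n ↑ʳ j) ≡ false
  star-adj-uu i j rewrite splitAt-↑ʳ n n i | splitAt-↑ʳ n n j = refl

  Stable-star⇔ : ∀ (x y : Subset n) → Stable (star G) (x ++ y) ⇔ (Stable G x × Disjoint x y)
  Stable-star⇔ x y = mk⇔ to′ from′
    where
    NoEdge : Fin (n + n) → Fin (n + n) → Set
    NoEdge a b = T (lookup (x ++ y) a) → T (lookup (x ++ y) b) → ¬ T (adj (star G) a b)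

    inˡ : ∀ {i} → T (lookup x i) → T (lookup (x ++ y) (i ↑ˡ n))
    inˡ {i} = subst T (sym (lookup-++ˡ x y i))

    inʳ : ∀ {i} → T (lookup y i) → T (lookup (x ++ y) (n ↑ʳ i))
    inʳ {i} = subst T (sym (lookup-++ʳ x y i))

    to′ : Stable (star G) (x ++ y) → Stable G x × Disjoint x y
    to′ h = (λ i j xᵢ xⱼ e → h (i ↑ˡ n) (j ↑ˡ n) (inˡ xᵢ) (inˡ xⱼ) (subst T (sym (star-adj-vv i j)) e))
          , (λ i xᵢ yᵢ → h (i ↑ˡ n) (n ↑ʳ i) (inˡ xᵢ) (inʳ yᵢ)
                            (subst T (sym (star-adj-vu i i)) (fromWitness refl)))

    vv : Stable G x → ∀ i j → NoEdge (i ↑ˡ n) (j ↑ˡ n)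
    vv s i j rewrite lookup-++ˡ x y i | lookup-++ˡ x y j | star-adj-vv i j = s i j

    vu : Disjoint x y → ∀ i j → NoEdge (i ↑ˡ n) (n ↑ʳ j)
    vu d i j rewrite lookup-++ˡ x y i | lookup-++ʳ x y j | star-adj-vu i j =
      λ xᵢ yⱼ i≟j → d i xᵢ (subst (T ∘ lookup y) (sym (toWitness i≟j)) yⱼ)

    uv : Disjoint x y → ∀ i j → NoEdge (n ↑ʳ i) (j ↑ˡ n)
    uv d i j rewrite lookup-++ʳ x y i | lookup-++ˡ x y j | star-adj-uv i j =
      λ yᵢ xⱼ i≟j → d j xⱼ (subst (T ∘ lookup y) (toWitness i≟j) yᵢ)

    uu : ∀ i j → NoEdge (n ↑ʳ i) (n ↑ʳ j)
    uu i j rewrite star-adj-uu i j = λ _ _ ()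

    from′ : Stable G x × Disjoint x y → Stable (star G) (x ++ y)
    from′ (s , d) = splitAt-elim n _ (λ i → splitAt-elim n _ (vv s i) (vu d i))
                                     (λ i → splitAt-elim n _ (uv d i) (uu i))

  isStable-star : ∀ (x y : Subset n) → isStable (star G) (x ++ y) ≡ isStable G x ∧ disjointᵇ x y
  isStable-star x y = T-⇔⇒≡ (⇔-sym T-∧ ⇔-∘ ((⇔-sym (T-isStable G x) ×-⇔ ⇔-sym (T-disjointᵇ x y))
                              ⇔-∘ (Stable-star⇔ x y ⇔-∘ T-isStable (star G) (x ++ y))))

[k+1]*[n+1]C[k+1]≡[n+1]*nCk : ∀ n k → suc k * (suc n C suc k) ≡ suc n * (n C k)
[k+1]*[n+1]C[k+1]≡[n+1]*nCk zero    zero    = refl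
[k+1]*[n+1]C[k+1]≡[n+1]*nCk zero    (suc k) = *-zeroʳ (suc (suc k))
[k+1]*[n+1]C[k+1]≡[n+1]*nCk (suc n) zero    =
  trans (+-identityʳ _) (trans (nC1≡n (suc (suc n))) (sym (*-identityʳ _)))
[k+1]*[n+1]C[k+1]≡[n+1]*nCk (suc n) (suc k) = begin
  suc K * (suc N C suc K)                     ≡⟨ cong (suc K *_) (nCk+nC[k+1]≡[n+1]C[k+1] N K) ⟨
  suc K * (N C K + N C suc K)                 ≡⟨ *-distribˡ-+ (suc K) (N C K) (N C suc K) ⟩
  (N C K + K * (N C K)) + suc K * (N C suc K) ≡⟨ cong₂ _+_ (cong (N C K +_) (IH k)) (IH K) ⟩
  (N C K + N * (n C k)) + N * (n C K)         ≡⟨ +-assoc (N C K) _ _ ⟩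
  N C K + (N * (n C k) + N * (n C K))         ≡⟨ cong (N C K +_) (*-distribˡ-+ N (n C k) (n C K)) ⟨
  N C K + N * (n C k + n C K)                 ≡⟨ cong (λ c → N C K + N * c) (nCk+nC[k+1]≡[n+1]C[k+1] n k) ⟩
  N C K + N * (N C K)                         ∎
  where
  open ≡-Reasoning
  N K : ℕ
  N = suc n
  K = suc k
  IH : ∀ k → suc k * (N C suc k) ≡ N * (n C k)
  IH = [k+1]*[n+1]C[k+1]≡[n+1]*nCk n

[k+1]*nC[k+1]+[k+1]*nCk≡[n+1]*nCk : ∀ n k → suc k * (n C suc k) + suc k * (n C k) ≡ suc n * (n C k)
[k+1]*nC[k+1]+[k+1]*nCk≡[n+1]*nCk n k = begin
  suc k * (n C suc k) + suc k * (n C k) ≡⟨ +-comm (suc k * (n C suc k)) _ ⟩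
  suc k * (n C k) + suc k * (n C suc k) ≡⟨ *-distribˡ-+ (suc k) (n C k) _ ⟨
  suc k * (n C k + n C suc k)           ≡⟨ cong (suc k *_) (nCk+nC[k+1]≡[n+1]C[k+1] n k) ⟩
  suc k * (suc n C suc k)               ≡⟨ [k+1]*[n+1]C[k+1]≡[n+1]*nCk n k ⟩
  suc n * (n C k)                       ∎
  where open ≡-Reasoning

-- c is twice the position of the peak, so that half-integer peaks stay in ℕ.
RisesBelowHalf : (ℕ → ℕ) → ℕ → Set
RisesBelowHalf a c = ∀ k → suc (k + k) ≤ c → a k ≤ a (suc k)

FallsAboveHalf : (ℕ → ℕ) → ℕ → Set
FallsAboveHalf a c = ∀ k → c ≤ suc (k + k) → a (suc k) ≤ a k

C-risesBelowHalf : ∀ n → RisesBelowHalf (n C_) n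
C-risesBelowHalf n k 2k<n = *-cancelˡ-≤ (suc k) (+-cancelʳ-≤ (suc k * (n C k)) _ _ (begin
  suc k * (n C k) + suc k * (n C k)     ≡⟨ *-distribʳ-+ (n C k) (suc k) (suc k) ⟨
  (suc k + suc k) * (n C k)             ≤⟨ *-monoˡ-≤ (n C k) 2[k+1]≤n+1 ⟩
  suc n * (n C k)                       ≡⟨ [k+1]*nC[k+1]+[k+1]*nCk≡[n+1]*nCk n k ⟨
  suc k * (n C suc k) + suc k * (n C k) ∎))
  where
  open ≤-Reasoning
  2[k+1]≤n+1 : suc k + suc k ≤ suc n
  2[k+1]≤n+1 = s≤s (subst (_≤ n) (sym (+-suc k k)) 2k<n)

C-fallsAboveHalf : ∀ n → FallsAboveHalf (n C_) n
C-fallsAboveHalf n k n≤2k+1 = *-cancelˡ-≤ (suc k) (+-cancelʳ-≤ (suc k * (n C k)) _ _ (begin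
  suc k * (n C suc k) + suc k * (n C k) ≡⟨ [k+1]*nC[k+1]+[k+1]*nCk≡[n+1]*nCk n k ⟩
  suc n * (n C k)                       ≤⟨ *-monoˡ-≤ (n C k) n+1≤2[k+1] ⟩
  (suc k + suc k) * (n C k)             ≡⟨ *-distribʳ-+ (n C k) (suc k) (suc k) ⟩
  suc k * (n C k) + suc k * (n C k)     ∎))
  where
  open ≤-Reasoning
  n+1≤2[k+1] : suc n ≤ suc k + suc k
  n+1≤2[k+1] = s≤s (subst (n ≤_) (sym (+-suc k k)) n≤2k+1)

shift : ℕ → (ℕ → ℕ) → ℕ → ℕ
shift zero    a k       = a k
shift (suc j) a zero    = 0
shift (suc j) a (suc k) = shift j a k

[1+j]+[1+j]+c≡2+[j+j+c] : ∀ j c → suc j + suc j + c ≡ 2 + (j + j + c)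
[1+j]+[1+j]+c≡2+[j+j+c] j c = cong (λ t → suc t + c) (+-suc j j)

shift-risesBelowHalf : ∀ {a c} → RisesBelowHalf a c → ∀ j → RisesBelowHalf (shift j a) (j + j + c)
shift-risesBelowHalf rises zero            = rises
shift-risesBelowHalf rises (suc j) zero    _ = z≤n
shift-risesBelowHalf rises (suc j) (suc k) h = shift-risesBelowHalf rises j k
  (+-cancelˡ-≤ 2 _ _ (subst₂ _≤_ (cong (2 +_) (+-suc k k)) ([1+j]+[1+j]+c≡2+[j+j+c] j _) h))

shift-fallsAboveHalf : ∀ {a c} → FallsAboveHalf a c → ∀ j → FallsAboveHalf (shift j a) (j + j + c)
shift-fallsAboveHalf falls zero            = falls
shift-fallsAboveHalf falls (suc j) zero    h =
  ⊥-elim (n≮0 (s≤s⁻¹ (subst (_≤ 1) ([1+j]+[1+j]+c≡2+[j+j+c] j _) h)))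
shift-fallsAboveHalf falls (suc j) (suc k) h = shift-fallsAboveHalf falls j k
  (+-cancelˡ-≤ 2 _ _ (subst₂ _≤_ ([1+j]+[1+j]+c≡2+[j+j+c] j _) (cong (2 +_) (+-suc k k)) h))

count-shift : ∀ (f : A → ℕ) (p : A → Bool) (a : ℕ → ℕ) xs →
  (∀ r → count (λ y → (f y ≡ᵇ r) ∧ p y) xs ≡ a r) →
  ∀ j k → count (λ y → (j + f y ≡ᵇ k) ∧ p y) xs ≡ shift j a k
count-shift f p a xs count≡a zero    k       = count≡a k
count-shift f p a xs count≡a (suc j) zero    = count-false xs
count-shift f p a xs count≡a (suc j) (suc k) = count-shift f p a xs count≡a j k

count-disjoint : ∀ (x : Subset n) r →
  count (λ y → (∣ y ∣ ≡ᵇ r) ∧ disjointᵇ x y) (allSubsets n) ≡ ∣ ∁ x ∣ C r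
count-disjoint []                  zero    = refl
count-disjoint []                  (suc r) = refl
count-disjoint {suc n} (true ∷ x)  r       =
  trans (sum-allSubsets-suc {n} _) (cong₂ _+_ none-with-true (count-disjoint x r))
  where
  none-with-true : count (λ y → (suc ∣ y ∣ ≡ᵇ r) ∧ false) (allSubsets n) ≡ 0
  none-with-true = trans (count-cong (λ _ → ∧-zeroʳ _) (allSubsets n)) (count-false (allSubsets n))
count-disjoint {suc n} (false ∷ x) zero    =
  trans (sum-allSubsets-suc {n} _) (cong₂ _+_ (count-false (allSubsets n)) (count-disjoint x 0))
count-disjoint {suc n} (false ∷ x) (suc r) =
  trans (sum-allSubsets-suc {n} _)
    (trans (cong₂ _+_ (count-disjoint x r) (count-disjoint x (suc r)))
           (nCk+nC[k+1]≡[n+1]C[k+1] ∣ ∁ x ∣ r))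

-- extensions x k = C(n − |x|, k − |x|), or 0 if k < |x|, counts the stable sets of G* of size k
-- whose original vertices form x: the other k − |x| vertices are pendant vertices u_i with i ∉ x.
extensions : Subset n → ℕ → ℕ
extensions x = shift ∣ x ∣ (∣ ∁ x ∣ C_)

∣x∣+∣x∣+∣∁x∣≡∣x∣+n : ∀ (x : Subset n) → ∣ x ∣ + ∣ x ∣ + ∣ ∁ x ∣ ≡ ∣ x ∣ + n
∣x∣+∣x∣+∣∁x∣≡∣x∣+n x = trans (+-assoc ∣ x ∣ ∣ x ∣ _) (cong (∣ x ∣ +_) (∣p∣+∣∁p∣≡n x))

extensions-risesBelowHalf : ∀ (x : Subset n) → RisesBelowHalf (extensions x) (∣ x ∣ + n)
extensions-risesBelowHalf x = subst (RisesBelowHalf (extensions x)) (∣x∣+∣x∣+∣∁x∣≡∣x∣+n x)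
  (shift-risesBelowHalf (C-risesBelowHalf ∣ ∁ x ∣) ∣ x ∣)

extensions-fallsAboveHalf : ∀ (x : Subset n) → FallsAboveHalf (extensions x) (∣ x ∣ + n)
extensions-fallsAboveHalf x = subst (FallsAboveHalf (extensions x)) (∣x∣+∣x∣+∣∁x∣≡∣x∣+n x)
  (shift-fallsAboveHalf (C-fallsAboveHalf ∣ ∁ x ∣) ∣ x ∣)

module _ {n} (G : Graph n) where

  s-star : ∀ k → s (star G) k ≡ sum (map (λ x → extensions x k) (stableSets G))
  s-star k = begin
    s (star G) k
      ≡⟨ length-filterᵇ P (allSubsets (n + n)) ⟩
    count P (allSubsets (n + n))
      ≡⟨ sum-allSubsets-++ n _ ⟩
    sum (map (λ x → count (λ y → P (x ++ y)) (allSubsets n)) (allSubsets n))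
      ≡⟨ cong sum (map-cong count-extensions (allSubsets n)) ⟩
    sum (map (λ x → if isStable G x then extensions x k else 0) (allSubsets n))
      ≡⟨ sum-map-filterᵇ (λ x → extensions x k) (isStable G) (allSubsets n) ⟨
    sum (map (λ x → extensions x k) (stableSets G)) ∎
    where
    open ≡-Reasoning
    P : Subset (n + n) → Bool
    P S = isStable (star G) S ∧ (∣ S ∣ ≡ᵇ k)

    rearrange : ∀ a b c → (a ∧ b) ∧ c ≡ a ∧ (c ∧ b)
    rearrange a b c = trans (∧-assoc a b c) (cong (a ∧_) (∧-comm b c))

    count-extensions : ∀ x →
      count (λ y → P (x ++ y)) (allSubsets n) ≡ (if isStable G x then extensions x k else 0)
    count-extensions x = begin
      count (λ y → P (x ++ y)) (allSubsets n)
        ≡⟨ count-cong (λ y → cong₂ _∧_ (isStable-star G x y) (cong (_≡ᵇ k) (∣p++q∣≡∣p∣+∣q∣ x y)))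
                      (allSubsets n) ⟩
      count (λ y → (isStable G x ∧ disjointᵇ x y) ∧ (∣ x ∣ + ∣ y ∣ ≡ᵇ k)) (allSubsets n)
        ≡⟨ count-cong (λ y → rearrange (isStable G x) (disjointᵇ x y) _) (allSubsets n) ⟩
      count (λ y → isStable G x ∧ ((∣ x ∣ + ∣ y ∣ ≡ᵇ k) ∧ disjointᵇ x y)) (allSubsets n)
        ≡⟨ count-∧ˡ (isStable G x) _ (allSubsets n) ⟩
      (if isStable G x then count (λ y → (∣ x ∣ + ∣ y ∣ ≡ᵇ k) ∧ disjointᵇ x y) (allSubsets n) else 0)
        ≡⟨ cong (λ c → if isStable G x then c else 0)
             (count-shift ∣_∣ (disjointᵇ x) (∣ ∁ x ∣ C_) (allSubsets n) (count-disjoint x) ∣ x ∣ k) ⟩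
      (if isStable G x then extensions x k else 0) ∎

  s-star-rises : ∀ k → suc (k + k) ≤ n → s (star G) k ≤ s (star G) (suc k)
  s-star-rises k 2k<n = begin
    s (star G) k                                          ≡⟨ s-star k ⟩
    sum (map (λ x → extensions x k) (stableSets G))       ≤⟨ sum-map-mono (All.tabulate rises) ⟩
    sum (map (λ x → extensions x (suc k)) (stableSets G)) ≡⟨ s-star (suc k) ⟨
    s (star G) (suc k)                                    ∎
    where
    open ≤-Reasoning
    rises : ∀ {x} → x ∈ stableSets G → extensions x k ≤ extensions x (suc k)
    rises {x} _ = extensions-risesBelowHalf x k (≤-trans 2k<n (m≤n+m n ∣ x ∣))

  s-star-falls : ∀ k → α G + n ≤ suc (k + k) → s (star G) (suc k) ≤ s (star G) k
  s-star-falls k α+n≤2k+1 = begin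
    s (star G) (suc k)                                    ≡⟨ s-star (suc k) ⟩
    sum (map (λ x → extensions x (suc k)) (stableSets G)) ≤⟨ sum-map-mono (All.tabulate falls) ⟩
    sum (map (λ x → extensions x k) (stableSets G))       ≡⟨ s-star k ⟨
    s (star G) k                                          ∎
    where
    open ≤-Reasoning
    falls : ∀ {x} → x ∈ stableSets G → extensions x (suc k) ≤ extensions x k
    falls {x} x∈ = extensions-fallsAboveHalf x k (≤-trans (+-monoˡ-≤ n (∣S∣≤α G x∈)) α+n≤2k+1)

rising⇒a[0]≤a[m] : ∀ {a : ℕ → ℕ} m → (∀ i → i < m → a i ≤ a (suc i)) → a 0 ≤ a m
rising⇒a[0]≤a[m] zero    _      = ≤-refl
rising⇒a[0]≤a[m] (suc m) rising =
  ≤-trans (rising⇒a[0]≤a[m] m (λ i i<m → rising i (m<n⇒m<1+n i<m))) (rising m ≤-refl)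

module _ {a : ℕ → ℕ} {m N : ℕ}
         (rising : ∀ i → i < m → a i ≤ a (suc i)) (falling : ∀ i → m < i → a (suc i) ≤ a i) where

  isMode-at : a (suc m) ≤ a m → m ≤ N → IsMode a N m
  isMode-at falls m≤N = m≤N , rising , λ i m≤i _ →
    [ falling i , (λ m≡i → subst (λ j → a (suc j) ≤ a j) m≡i falls) ]′ (m≤n⇒m<n∨m≡n m≤i)

  isMode-at-suc : a m ≤ a (suc m) → suc m ≤ N → IsMode a N (suc m)
  isMode-at-suc rises m<N = m<N
    , (λ i i≤m → [ rising i , (λ i≡m → subst (λ j → a j ≤ a (suc j)) (sym i≡m) rises) ]′
                   (m≤n⇒m<n∨m≡n (s≤s⁻¹ i≤m)))
    , λ i m<i _ → falling i m<i

m*2≡m+m : ∀ m → m * 2 ≡ m + m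
m*2≡m+m m = trans (*-comm m 2) (cong (m +_) (+-identityʳ m))

[1+n]/2+[1+n]/2≤1+n : ∀ n → suc n / 2 + suc n / 2 ≤ suc n
[1+n]/2+[1+n]/2≤1+n n = subst (_≤ suc n) (m*2≡m+m (suc n / 2)) (m/n*n≤m (suc n) 2)

n≤[1+n]/2+[1+n]/2 : ∀ n → n ≤ suc n / 2 + suc n / 2
n≤[1+n]/2+[1+n]/2 n = s≤s⁻¹ (begin
  suc n                       ≡⟨ m≡m%n+[m/n]*n (suc n) 2 ⟩
  suc n % 2 + suc n / 2 * 2   ≤⟨ +-monoˡ-≤ _ (s≤s⁻¹ (m%n<n (suc n) 2)) ⟩
  1 + suc n / 2 * 2           ≡⟨ cong suc (m*2≡m+m (suc n / 2)) ⟩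
  suc (suc n / 2 + suc n / 2) ∎)
  where open ≤-Reasoning

odd⇒[1+n]/2+[1+n]/2≡1+n : ∀ n → n % 2 ≡ 1 → suc n / 2 + suc n / 2 ≡ suc n
odd⇒[1+n]/2+[1+n]/2≡1+n n odd = begin
  suc n / 2 + suc n / 2     ≡⟨ m*2≡m+m (suc n / 2) ⟨
  suc n / 2 * 2             ≡⟨ cong (_+ suc n / 2 * 2) [1+n]%2≡0 ⟨
  suc n % 2 + suc n / 2 * 2 ≡⟨ m≡m%n+[m/n]*n (suc n) 2 ⟨
  suc n                     ∎
  where
  open ≡-Reasoning
  [1+n]%2≡0 : suc n % 2 ≡ 0
  [1+n]%2≡0 = trans (%-distribˡ-+ 1 n 2) (cong (λ r → (1 + r) % 2) odd)

module Centre {n} (G : Graph n) where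

  centre : ℕ
  centre = suc n / 2

  rising : ∀ i → i < centre → s (star G) i ≤ s (star G) (suc i)
  rising i i<c = s-star-rises G i (s≤s⁻¹ (begin
    suc (suc (i + i)) ≡⟨ cong suc (+-suc i i) ⟨
    suc i + suc i     ≤⟨ +-mono-≤ i<c i<c ⟩
    centre + centre   ≤⟨ [1+n]/2+[1+n]/2≤1+n n ⟩
    suc n             ∎))
    where open ≤-Reasoning

  falling : α G ≤ 3 → ∀ i → centre < i → s (star G) (suc i) ≤ s (star G) i
  falling α≤3 i c<i = s-star-falls G i (begin
    α G + n                       ≤⟨ +-mono-≤ α≤3 (n≤[1+n]/2+[1+n]/2 n) ⟩
    3 + (centre + centre)         ≡⟨ cong (2 +_) (+-suc centre centre) ⟨
    suc (suc centre + suc centre) ≤⟨ s≤s (+-mono-≤ c<i c<i) ⟩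
    suc (i + i)                   ∎)
    where open ≤-Reasoning

  falls-at-centre : (α G ≡ 2 × n % 2 ≡ 1) ⊎ α G ≡ 1 → s (star G) (suc centre) ≤ s (star G) centre
  falls-at-centre (inj₁ (α≡2 , odd)) = s-star-falls G centre (≤-reflexive (begin
    α G + n               ≡⟨ cong (_+ n) α≡2 ⟩
    suc (suc n)           ≡⟨ cong suc (odd⇒[1+n]/2+[1+n]/2≡1+n n odd) ⟨
    suc (centre + centre) ∎))
    where open ≡-Reasoning
  falls-at-centre (inj₂ α≡1) = s-star-falls G centre
    (subst (λ a → a + n ≤ suc (centre + centre)) (sym α≡1) (s≤s (n≤[1+n]/2+[1+n]/2 n)))

  centre≤α* : centre ≤ α (star G)
  centre≤α* = 0<s⇒≤α (star G) centre (<-≤-trans (0<s[0] (star G)) (rising⇒a[0]≤a[m] centre rising))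

  mode-near-centre : α G ≤ 3 → ∃ λ k → IsModeOfI (star G) k × centre ≤ k × k ≤ centre + 1
  mode-near-centre α≤3 with s (star G) (suc centre) ≤? s (star G) centre
  ... | yes falls = centre , isMode-at rising (falling α≤3) falls centre≤α* , ≤-refl , m≤m+n centre 1
  ... | no ¬falls = suc centre , isMode-at-suc rising (falling α≤3) (<⇒≤ rises) suc-centre≤α*
                  , n≤1+n centre , ≤-reflexive (+-comm 1 centre)
    where
    rises : s (star G) centre < s (star G) (suc centre)
    rises = ≰⇒> ¬falls
    suc-centre≤α* : suc centre ≤ α (star G)
    suc-centre≤α* = 0<s⇒≤α (star G) (suc centre) (≤-<-trans z≤n rises)

-- IsSimple G is unused: nothing here depends on adj being symmetric or loopless.
theorem3 : (n : ℕ) (G : Graph n) → IsSimple G → α G ≤ 3 →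
    IsUnimodalI (star G)
    × (∃ λ k → IsModeOfI (star G) k × (suc n / 2 ≤ k) × (k ≤ suc n / 2 + 1))
    × (((α G ≡ 2 × n % 2 ≡ 1) ⊎ α G ≡ 1) → IsModeOfI (star G) (suc n / 2))
theorem3 n G _ α≤3 =
  let k , k-is-mode , near-centre = mode-near-centre α≤3
  in (k , k-is-mode) , (k , k-is-mode , near-centre)
   , λ special → isMode-at rising (falling α≤3) (falls-at-centre special) centre≤α*
  where open Centre G
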